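{- Let $G$ be any graph, $s$ a positive integer, and $x_i \in V(G)$. Let $G_i'$ be the graph obtained from $G$ by adding one new vertex $x'$ and the single edge $x_i x'$. Then $\pi_{2s}(G, x_i) = \pi_s(G_i', x')$.
   Context: Graphs are finite and undirected. A distribution on a graph is a function from its vertex set to $\mathbb{N}$ (numbers of pebbles). A pebbling move removes two pebbles from some vertex and places one pebble on an adjacent vertex. For a vertex $v$ of a graph $G$ and positive integer $t$, $\pi_t(G,v)$ is the smallest number $N$ such that, from every distribution with at least $N$ pebbles on $G$, a sequence of pebbling moves yields a distribution with at least $t$ pebbles on $v$ ($\infty$ if no such $N$ exists). -}

module Defs where

open import Level using (0ℓ)
open import Data.Nat using (ℕ; zero; suc; _+_; _*_; _≤_)
open import Data.Fin using (Fin; zero; suc)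
open import Data.List using (List; map)
open import Data.Nat.ListAction using (sum)
open import Data.List.Base using () renaming (allFin to allFinL)
open import Data.Product using (Σ; _×_; ∃-syntax)
open import Data.Empty using (⊥)
open import Relation.Nullary using (¬_)
open import Relation.Binary.PropositionalEquality using (_≡_; _≢_)
open import Relation.Binary.Construct.Closure.ReflexiveTransitive using (Star)

record Graph (n : ℕ) : Set₁ where
  field
    Adj     : Fin n → Fin n → Set
    sym     : ∀ {u v} → Adj u v → Adj v u
    irrefl  : ∀ {u} → ¬ Adj u u
open Graph public

Distribution : ℕ → Set
Distribution n = Fin n → ℕ

size : ∀ {n} → Distribution n → ℕ
size {n} D = sum (map D (allFinL n))

Move : ∀ {n} → Graph n → Distribution n → Distribution n → Set
Move {n} G D D' =
  Σ (Fin n) λ u → Σ (Fin n) λ v →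
    Adj G u v × 2 ≤ D u × D' u + 2 ≡ D u × D' v ≡ suc (D v)
    × (∀ w → w ≢ u → w ≢ v → D' w ≡ D w)

Reachable : ∀ {n} → Graph n → Distribution n → Distribution n → Set
Reachable G = Star (Move G)

Solvable : ∀ {n} → Graph n → ℕ → Fin n → Distribution n → Set
Solvable G t v D = ∃[ D' ] (Reachable G D D' × t ≤ D' v)

Good : ∀ {n} → Graph n → ℕ → Fin n → ℕ → Set
Good {n} G t v N = ∀ (D : Distribution n) → N ≤ size D → Solvable G t v D

IsPebblingNumber : ∀ {n} → Graph n → ℕ → Fin n → ℕ → Set
IsPebblingNumber G t v N = Good G t v N × (∀ M → Good G t v M → N ≤ M)

PebblingNumberInfinite : ∀ {n} → Graph n → ℕ → Fin n → Set
PebblingNumberInfinite G t v = ∀ N → ¬ Good G t v N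

-- G'_x : add a new vertex (zero) adjacent only to x; old vertex i becomes suc i.
pendantAdj : ∀ {n} → Graph n → Fin n → Fin (suc n) → Fin (suc n) → Set
pendantAdj G x zero    zero    = ⊥
pendantAdj G x zero    (suc j) = j ≡ x
pendantAdj G x (suc i) zero    = i ≡ x
pendantAdj G x (suc i) (suc j) = Adj G i j

pendantSym : ∀ {n} (G : Graph n) (x : Fin n) {u v} →
             pendantAdj G x u v → pendantAdj G x v u
pendantSym G x {zero}  {suc j} p = p
pendantSym G x {suc i} {zero}  p = p
pendantSym G x {suc i} {suc j} p = sym G p

pendantIrrefl : ∀ {n} (G : Graph n) (x : Fin n) {u} → ¬ pendantAdj G x u u
pendantIrrefl G x {zero}  ()
pendantIrrefl G x {suc i} p = irrefl G p

addPendant : ∀ {n} → Graph n → Fin n → Graph (suc n)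
addPendant G x = record
  { Adj = pendantAdj G x ; sym = λ {u} {v} → pendantSym G x {u} {v} ; irrefl = λ {u} → pendantIrrefl G x {u} }

newVertex : ∀ {n} → Fin (suc n)
newVertex = zero

module Submission where

-- We show that for every N,
--   every N-pebble distribution on G can put 2s pebbles on x
--   iff every N-pebble distribution on G'_x can put s pebbles on x',
-- from which both parts of the theorem follow at once (pebbling-number-transfer).
--
-- (⇒) Given a distribution with a pebbles on x' and R on G, solve the distribution
--     R ⊕ (2a pebbles on x) in G.  By the removal lemma, dropping the 2a extra pebbles
--     costs at most 2a pebbles on x, so R alone reaches 2(s ∸ a) pebbles on x; these
--     are then moved across the pendant edge.  The removal lemma treats the dropped
--     pebbles as phantoms: a move the real pebbles cannot pay for relocates a phantom.
-- (⇐) Given D on G, solve 0 ∷ D in G'_x.  Collapsing x' onto x with weight two turns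
--     every move of G'_x into a move of G or into a step that does not increase the
--     collapsed distribution, so G itself reaches 2·(pebbles on x') pebbles on x.

open import Defs hiding (sym)
open import Data.Nat using (ℕ; zero; suc; _+_; _*_; _∸_; _≤_; z≤n; s≤s; _≤?_)
open import Data.Nat.Properties hiding (_≟_; suc-injective)
open import Data.Nat.ListAction using (sum)
open import Data.Nat.Tactic.RingSolver using (solve-∀)
open import Data.Fin using (Fin; zero; suc)
open import Data.Fin.Properties using (_≟_; suc-injective)
open import Data.Vec.Functional using (head; tail; _∷_; updateAt)
open import Data.Vec.Functional.Properties using (updateAt-updates; updateAt-minimal)
open import Data.List.Properties using (map-tabulate)
open import Data.Product using (_×_; _,_; ∃-syntax)
open import Function using (_∘_; id)
open import Function.Bundles using (_⇔_; mk⇔; Equivalence)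
open import Relation.Nullary using (¬_; yes; no)
open import Relation.Binary.PropositionalEquality
open import Relation.Binary.Construct.Closure.ReflexiveTransitive using (ε; _◅_; _◅◅_; gmap)

private
  variable
    n : ℕ

_≤ᴰ_ : Distribution n → Distribution n → Set
D ≤ᴰ H = ∀ i → D i ≤ H i

_⊕_ : Distribution n → Distribution n → Distribution n
(D ⊕ E) i = D i + E i

pile : Fin n → ℕ → Distribution n
pile u k = updateAt (λ _ → 0) u (λ _ → k)

pile-here : (u : Fin n) (k : ℕ) → pile u k u ≡ k
pile-here u k = updateAt-updates u (λ _ → 0)

pile-elsewhere : {u w : Fin n} (k : ℕ) → w ≢ u → pile u k w ≡ 0
pile-elsewhere {u = u} {w} k w≢u = updateAt-minimal w u (λ _ → 0) w≢u

pile-empty : (u w : Fin n) → pile u 0 w ≡ 0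
pile-empty u w with w ≟ u
... | yes refl = pile-here u 0
... | no w≢u   = pile-elsewhere 0 w≢u

size-tail : (D : Distribution (suc n)) → size D ≡ head D + size (tail D)
size-tail D = cong (λ xs → head D + sum xs)
                   (trans (map-tabulate suc D) (sym (map-tabulate id (tail D))))

size-updateAt : (D : Distribution n) (u : Fin n) (f : ℕ → ℕ) →
                size (updateAt D u f) + D u ≡ size D + f (D u)
size-updateAt {suc n} D zero f = begin
  size (updateAt D zero f) + head D  ≡⟨ cong (_+ head D) (size-tail (updateAt D zero f)) ⟩
  f (head D) + size (tail D) + head D ≡⟨ swap-ends (f (head D)) (size (tail D)) (head D) ⟩
  head D + size (tail D) + f (head D) ≡⟨ cong (_+ f (head D)) (sym (size-tail D)) ⟩
  size D + f (head D)                 ∎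
  where
  open ≡-Reasoning
  swap-ends : ∀ a b c → a + b + c ≡ c + b + a
  swap-ends = solve-∀
size-updateAt {suc n} D (suc u) f = begin
  size (updateAt D (suc u) f) + D (suc u)             ≡⟨ cong (_+ D (suc u)) (size-tail (updateAt D (suc u) f)) ⟩
  head D + size (updateAt (tail D) u f) + D (suc u)   ≡⟨ +-assoc (head D) _ _ ⟩
  head D + (size (updateAt (tail D) u f) + D (suc u)) ≡⟨ cong (head D +_) (size-updateAt (tail D) u f) ⟩
  head D + (size (tail D) + f (D (suc u)))            ≡⟨ sym (+-assoc (head D) _ _) ⟩
  head D + size (tail D) + f (D (suc u))              ≡⟨ cong (_+ f (D (suc u))) (sym (size-tail D)) ⟩
  size D + f (D (suc u))                              ∎
  where open ≡-Reasoning

size-⊕ : (D E : Distribution n) → size (D ⊕ E) ≡ size D + size E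
size-⊕ {zero}  D E = refl
size-⊕ {suc n} D E = begin
  size (D ⊕ E)                                  ≡⟨ size-tail (D ⊕ E) ⟩
  head D + head E + size (tail D ⊕ tail E)      ≡⟨ cong (head D + head E +_) (size-⊕ (tail D) (tail E)) ⟩
  head D + head E + (size (tail D) + size (tail E)) ≡⟨ +-assoc-middle (head D) (head E) _ _ ⟩
  head D + size (tail D) + (head E + size (tail E)) ≡⟨ sym (cong₂ _+_ (size-tail D) (size-tail E)) ⟩
  size D + size E                               ∎
  where
  open ≡-Reasoning
  +-assoc-middle : ∀ a b c d → a + b + (c + d) ≡ a + c + (b + d)
  +-assoc-middle = solve-∀

size-zero : size {n} (λ _ → 0) ≡ 0
size-zero {zero}  = refl
size-zero {suc n} = trans (size-tail {n} (λ _ → 0)) (size-zero {n})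

size-pile : (u : Fin n) (k : ℕ) → size (pile u k) ≡ k
size-pile {n} u k = trans (sym (+-identityʳ _))
                          (trans (size-updateAt (λ _ → 0) u (λ _ → k)) (cong (_+ k) (size-zero {n})))

point≤size : (D : Distribution n) (u : Fin n) → D u ≤ size D
point≤size D zero    = ≤-trans (m≤m+n (head D) _) (≤-reflexive (sym (size-tail D)))
point≤size D (suc u) = ≤-trans (point≤size (tail D) u)
                               (≤-trans (m≤n+m _ (head D)) (≤-reflexive (sym (size-tail D))))

by-cases : {P : Fin n → Set} (u v : Fin n) → P u → P v →
           (∀ w → w ≢ u → w ≢ v → P w) → ∀ w → P w
by-cases u v at-u at-v elsewhere w with w ≟ u | w ≟ v
... | yes refl | _        = at-u
... | no _     | yes refl = at-v
... | no w≢u   | no w≢v   = elsewhere w w≢u w≢v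

Shifted : Fin n → Fin n → Distribution n → Distribution n → Set
Shifted u v D D' = D' u + 2 ≡ D u × D' v ≡ suc (D v) × (∀ w → w ≢ u → w ≢ v → D' w ≡ D w)

Covers : Fin n → Fin n → Distribution n → Distribution n → Set
Covers u v H H' = H u ≤ H' u + 2 × suc (H v) ≤ H' v × (∀ w → w ≢ u → w ≢ v → H w ≤ H' w)

shifted⇒covers : {u v : Fin n} {H H' : Distribution n} → Shifted u v H H' → Covers u v H H'
shifted⇒covers (at-u , at-v , elsewhere) =
  ≤-reflexive (sym at-u) , ≤-reflexive (sym at-v) , λ w p q → ≤-reflexive (sym (elsewhere w p q))

covers-dominates : {u v : Fin n} {D D' H H' : Distribution n} →
                   Shifted u v D D' → D ≤ᴰ H → Covers u v H H' → D' ≤ᴰ H'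
covers-dominates {u = u} {v} {D} {D'} {H} {H'} (d-u , d-v , d-else) D≤H (h-u , h-v , h-else) =
  by-cases u v at-u at-v elsewhere
  where
  at-u : D' u ≤ H' u
  at-u = +-cancelʳ-≤ 2 (D' u) (H' u) (≤-trans (≤-reflexive d-u) (≤-trans (D≤H u) h-u))
  at-v : D' v ≤ H' v
  at-v = ≤-trans (≤-reflexive d-v) (≤-trans (s≤s (D≤H v)) h-v)
  elsewhere : ∀ w → w ≢ u → w ≢ v → D' w ≤ H' w
  elsewhere w p q = ≤-trans (≤-reflexive (d-else w p q)) (≤-trans (D≤H w) (h-else w p q))

shifted-⊕ : {u v : Fin n} {D D' : Distribution n} (E : Distribution n) →
            Shifted u v D D' → Shifted u v (D ⊕ E) (D' ⊕ E)
shifted-⊕ {u = u} {D' = D'} E (at-u , at-v , elsewhere) =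
  trans (+-swap (D' u) (E u) 2) (cong (_+ E u) at-u) ,
  cong (_+ _) at-v ,
  λ w p q → cong (_+ E w) (elsewhere w p q)
  where
  +-swap : ∀ a b c → a + b + c ≡ a + c + b
  +-swap = solve-∀

transfer : ℕ → Distribution n → Fin n → Fin n → Distribution n
transfer k D u v = updateAt (updateAt D u (_∸ k)) v suc

module _ {k : ℕ} {D : Distribution n} {u v : Fin n} where

  transfer-source : u ≢ v → transfer k D u v u ≡ D u ∸ k
  transfer-source u≢v = trans (updateAt-minimal u v _ u≢v) (updateAt-updates u D)

  transfer-target : u ≢ v → transfer k D u v v ≡ suc (D v)
  transfer-target u≢v = trans (updateAt-updates v _) (cong suc (updateAt-minimal v u D (u≢v ∘ sym)))

  transfer-elsewhere : ∀ w → w ≢ u → w ≢ v → transfer k D u v w ≡ D w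
  transfer-elsewhere w w≢u w≢v = trans (updateAt-minimal w v _ w≢v) (updateAt-minimal w u D w≢u)

transfer-shifted : {D : Distribution n} {u v : Fin n} →
                   u ≢ v → 2 ≤ D u → Shifted u v D (transfer 2 D u v)
transfer-shifted {D = D} u≢v two =
  trans (cong (_+ 2) (transfer-source {k = 2} {D} u≢v)) (m∸n+n≡m two) ,
  transfer-target {k = 2} {D} u≢v ,
  transfer-elsewhere {k = 2} {D}

relocation-covers : {H E : Distribution n} {u v : Fin n} → u ≢ v →
                    Covers u v (H ⊕ E) (H ⊕ transfer 1 E u v)
relocation-covers {H = H} {E} {u} {v} u≢v = at-u , at-v , elsewhere
  where
  m≤m∸1+2 : ∀ m → m ≤ m ∸ 1 + 2
  m≤m∸1+2 zero    = z≤n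
  m≤m∸1+2 (suc m) = ≤-trans (n≤1+n (suc m)) (≤-reflexive (+-comm 2 m))
  at-u : H u + E u ≤ H u + transfer 1 E u v u + 2
  at-u rewrite transfer-source {k = 1} {E} u≢v =
    ≤-trans (+-monoʳ-≤ (H u) (m≤m∸1+2 (E u))) (≤-reflexive (sym (+-assoc (H u) _ 2)))
  at-v : suc (H v + E v) ≤ H v + transfer 1 E u v v
  at-v rewrite transfer-target {k = 1} {E} u≢v = ≤-reflexive (sym (+-suc (H v) (E v)))
  elsewhere : ∀ w → w ≢ u → w ≢ v → H w + E w ≤ H w + transfer 1 E u v w
  elsewhere w p q = ≤-reflexive (cong (H w +_) (sym (transfer-elsewhere {k = 1} {E} w p q)))

size-relocation : {E : Distribution n} {u v : Fin n} → 1 ≤ E u → size (transfer 1 E u v) ≡ size E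
size-relocation {E = E} {u} {v} occupied = +-cancelʳ-≡ m _ _ (begin
  size (transfer 1 E u v) + m  ≡⟨ +-cancelʳ-≡ (E₁ v) _ _ moved-on ⟩
  suc (size E₁) + m            ≡⟨ sym (+-suc (size E₁) m) ⟩
  size E₁ + suc m              ≡⟨ cong (size E₁ +_) (trans (+-comm 1 m) (m∸n+n≡m occupied)) ⟩
  size E₁ + E u                ≡⟨ size-updateAt E u (_∸ 1) ⟩
  size E + m                   ∎)
  where
  open ≡-Reasoning
  m  = E u ∸ 1
  E₁ = updateAt E u (_∸ 1)
  moved-on : size (transfer 1 E u v) + m + E₁ v ≡ suc (size E₁) + m + E₁ v
  moved-on = begin
    size (transfer 1 E u v) + m + E₁ v   ≡⟨ +-swap (size (transfer 1 E u v)) m (E₁ v) ⟩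
    size (transfer 1 E u v) + E₁ v + m   ≡⟨ cong (_+ m) (size-updateAt E₁ v suc) ⟩
    size E₁ + suc (E₁ v) + m             ≡⟨ cong (_+ m) (+-suc (size E₁) (E₁ v)) ⟩
    suc (size E₁) + E₁ v + m             ≡⟨ +-swap (suc (size E₁)) (E₁ v) m ⟩
    suc (size E₁) + m + E₁ v             ∎
    where
    +-swap : ∀ a b c → a + b + c ≡ a + c + b
    +-swap = solve-∀

adj⇒≢ : (G : Graph n) {u v : Fin n} → Adj G u v → u ≢ v
adj⇒≢ G a refl = irrefl G a

pebblingMove : (G : Graph n) {D : Distribution n} {u v : Fin n} →
               Adj G u v → 2 ≤ D u → Move G D (transfer 2 D u v)
pebblingMove G adj two = _ , _ , adj , two , transfer-shifted (adj⇒≢ G adj) two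

solvable-resp-≗ : {G : Graph n} {t : ℕ} {v : Fin n} {D D' : Distribution n} →
                  (∀ i → D i ≡ D' i) → Solvable G t v D → Solvable G t v D'
solvable-resp-≗ {v = v} {D' = D'} D≗D' (_ , ε , t≤) = D' , ε , subst (_ ≤_) (D≗D' v) t≤
solvable-resp-≗ D≗D' (F , (u , w , adj , two , at-u , at-w , elsewhere) ◅ moves , t≤) =
  F , (u , w , adj , subst (2 ≤_) (D≗D' u) two , trans at-u (D≗D' u) ,
       trans at-w (cong suc (D≗D' w)) , (λ y p q → trans (elsewhere y p q) (D≗D' y))) ◅ moves , t≤

repeatedMoves : (G : Graph n) {u v : Fin n} → Adj G u v → ∀ j {D : Distribution n} →
                2 * j ≤ D u → ∃[ D' ] (Reachable G D D' × D' v ≡ D v + j)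
repeatedMoves G adj zero {D} _ = D , ε , sym (+-identityʳ _)
repeatedMoves G {u} {v} adj (suc j) {D} enough =
  let D' , moves , D'v = repeatedMoves G adj j {transfer 2 D u v} rest
  in D' , pebblingMove G adj two ◅ moves ,
     trans D'v (trans (cong (_+ j) (transfer-target {k = 2} {D} u≢v)) (sym (+-suc (D v) j)))
  where
  u≢v = adj⇒≢ G adj
  enough' : 2 + 2 * j ≤ D u
  enough' = ≤-trans (≤-reflexive (sym (*-suc 2 j))) enough
  two : 2 ≤ D u
  two = ≤-trans (m≤m+n 2 (2 * j)) enough'
  rest : 2 * j ≤ transfer 2 D u v u
  rest rewrite transfer-source {k = 2} {D} u≢v =
    m+n≤o⇒m≤o∸n (2 * j) (≤-trans (≤-reflexive (+-comm (2 * j) 2)) enough')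

-- Some phantom pebble sits on u when the real pebbles cannot pay for a move from u.
phantom-present : ∀ {s h e} → 2 ≤ s → s ≤ h + e → ¬ 2 ≤ h → 1 ≤ e
phantom-present {h = h} {e} two s≤ few = +-cancelˡ-≤ 1 1 e (≤-trans two (≤-trans s≤ (+-monoˡ-≤ e h≤1)))
  where
  h≤1 : h ≤ 1
  h≤1 = ≤-pred (≰⇒> few)

-- Pebble removal: if S ≤ H ⊕ E and S reaches F, then H reaches some H' with F ≤ H' ⊕ E'
-- where E' has as many pebbles as E.  Moves that H cannot pay for relocate a pebble of E.
removal : (G : Graph n) {S F : Distribution n} → Reachable G S F →
          ∀ {H E} → S ≤ᴰ (H ⊕ E) →
          ∃[ H' ] ∃[ E' ] (Reachable G H H' × size E' ≡ size E × F ≤ᴰ (H' ⊕ E'))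
removal G ε {H} {E} dom = H , E , ε , refl , dom
removal G ((u , v , adj , two , shifted) ◅ moves) {H} {E} dom with 2 ≤? H u
... | yes paid =
  let H' , E' , moves' , same-size , dom' =
        removal G moves (covers-dominates shifted dom
                          (shifted⇒covers (shifted-⊕ E (transfer-shifted (adj⇒≢ G adj) paid))))
  in H' , E' , pebblingMove G adj paid ◅ moves' , same-size , dom'
... | no unpaid =
  let H' , E' , moves' , same-size , dom' =
        removal G moves (covers-dominates shifted dom (relocation-covers (adj⇒≢ G adj)))
  in H' , E' , moves' ,
     trans same-size (size-relocation {v = v} (phantom-present two (dom u) unpaid)) , dom'

removal-at : (G : Graph n) {H E F : Distribution n} → Reachable G (H ⊕ E) F → ∀ t →
             ∃[ H' ] (Reachable G H H' × F t ≤ H' t + size E)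
removal-at G moves t =
  let H' , E' , moves' , same-size , dom = removal G moves (λ _ → ≤-refl)
  in H' , moves' ,
     ≤-trans (dom t) (+-monoʳ-≤ (H' t) (≤-trans (point≤size E' t) (≤-reflexive same-size)))

-- In G'_x = addPendant G x the new vertex x' is zero and the old vertex i is suc i;
-- a distribution on G'_x is written c ∷ H with c pebbles on x' and H on G.
module Pendant (G : Graph n) (x : Fin n) where

  G' : Graph (suc n)
  G' = addPendant G x

  liftMove : (c : ℕ) {H H₁ : Distribution n} → Move G H H₁ → Move G' (c ∷ H) (c ∷ H₁)
  liftMove c (u , v , adj , two , at-u , at-v , elsewhere) =
    suc u , suc v , adj , two , at-u , at-v , elsewhere'
    where
    elsewhere' : ∀ w → w ≢ suc u → w ≢ suc v → (c ∷ _) w ≡ (c ∷ _) w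
    elsewhere' zero    _ _ = refl
    elsewhere' (suc w) p q = elsewhere w (p ∘ cong suc) (q ∘ cong suc)

  lift : (c : ℕ) {H F : Distribution n} → Reachable G H F → Reachable G' (c ∷ H) (c ∷ F)
  lift c = gmap (c ∷_) (liftMove c)

  collapse : Distribution (suc n) → Distribution n
  collapse S = tail S ⊕ pile x (2 * head S)

  collapse-at-x : (S : Distribution (suc n)) → collapse S x ≡ S (suc x) + 2 * head S
  collapse-at-x S = cong (S (suc x) +_) (pile-here x (2 * head S))

  collapse-away : (S : Distribution (suc n)) {k : Fin n} → k ≢ x → collapse S k ≡ S (suc k)
  collapse-away S k≢x = trans (cong (_ +_) (pile-elsewhere (2 * head S) k≢x)) (+-identityʳ _)

  collapse-≤ : {S S' : Distribution (suc n)} →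
               S' (suc x) + 2 * head S' ≤ S (suc x) + 2 * head S →
               (∀ k → k ≢ x → S' (suc k) ≡ S (suc k)) → collapse S' ≤ᴰ collapse S
  collapse-≤ {S} {S'} at-x away k with k ≟ x
  ... | yes refl = ≤-trans (≤-reflexive (collapse-at-x S')) (≤-trans at-x (≤-reflexive (sym (collapse-at-x S))))
  ... | no k≢x   = ≤-reflexive (trans (collapse-away S' k≢x) (trans (away k k≢x) (sym (collapse-away S k≢x))))

  -- A move x' → x trades weight four for weight one.
  collapse-out : {S S' : Distribution (suc n)} → Shifted zero (suc x) S S' → collapse S' ≤ᴰ collapse S
  collapse-out {S} {S'} (at-x' , at-x , elsewhere) = collapse-≤ {S} {S'} weight (λ k k≢x → elsewhere (suc k) (λ ()) (k≢x ∘ suc-injective))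
    where
    loses-three : ∀ a b → suc a + 2 * b + 3 ≡ a + 2 * (b + 2)
    loses-three = solve-∀
    weight : S' (suc x) + 2 * head S' ≤ S (suc x) + 2 * head S
    weight rewrite at-x | sym at-x' =
      ≤-trans (m≤m+n _ 3) (≤-reflexive (loses-three (S (suc x)) (head S')))

  collapse-in : {S S' : Distribution (suc n)} → Shifted (suc x) zero S S' → collapse S' ≤ᴰ collapse S
  collapse-in {S} {S'} (at-x , at-x' , elsewhere) = collapse-≤ {S} {S'} weight (λ k k≢x → elsewhere (suc k) (k≢x ∘ suc-injective) (λ ()))
    where
    preserved : ∀ a b → a + 2 * suc b ≡ a + 2 + 2 * b
    preserved = solve-∀
    weight : S' (suc x) + 2 * head S' ≤ S (suc x) + 2 * head S
    weight rewrite at-x' | sym at-x = ≤-reflexive (preserved (S' (suc x)) (head S))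

  collapse-shifted : {i j : Fin n} {S S' : Distribution (suc n)} →
                     Shifted (suc i) (suc j) S S' → Shifted i j (collapse S) (collapse S')
  collapse-shifted {S = S} {S'} (at-i , at-j , elsewhere) =
    subst (λ c → Shifted _ _ (collapse S) (tail S' ⊕ pile x (2 * c))) (sym same-head)
          (shifted-⊕ (pile x (2 * head S))
             (at-i , at-j , λ w p q → elsewhere (suc w) (p ∘ suc-injective) (q ∘ suc-injective)))
    where
    same-head : head S' ≡ head S
    same-head = elsewhere zero (λ ()) (λ ())

  project : {S F : Distribution (suc n)} → Reachable G' S F → ∀ {H} → collapse S ≤ᴰ H →
            ∃[ H' ] (Reachable G H H' × collapse F ≤ᴰ H')
  project ε {H} dom = H , ε , dom
  project ((zero , zero , () , _) ◅ _) dom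
  project ((zero , suc .x , refl , _ , shifted) ◅ moves) dom =
    project moves (λ k → ≤-trans (collapse-out shifted k) (dom k))
  project ((suc .x , zero , refl , _ , shifted) ◅ moves) dom =
    project moves (λ k → ≤-trans (collapse-in shifted k) (dom k))
  project {S} ((suc i , suc j , adj , two , shifted) ◅ moves) {H} dom =
    let H' , moves' , dom' =
          project moves (covers-dominates (collapse-shifted shifted) dom
                          (shifted⇒covers (transfer-shifted (adj⇒≢ G adj) paid)))
    in H' , pebblingMove G adj paid ◅ moves' , dom'
    where
    paid : 2 ≤ H i
    paid = ≤-trans two (≤-trans (m≤m+n (S (suc i)) _) (dom i))

  pendant-good : ∀ s N → Good G (2 * s) x N → Good G' s zero N
  pendant-good s N good D N≤ =
    solvable-resp-≗ {G = G'} head∷tail (spread (head D) (tail D) (≤-trans N≤ (≤-reflexive (size-tail D))))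
    where
    head∷tail : ∀ i → (head D ∷ tail D) i ≡ D i
    head∷tail zero    = refl
    head∷tail (suc i) = refl
    spread : ∀ a R → N ≤ a + size R → Solvable G' s zero (a ∷ R)
    spread a R N≤ =
      let F , moves , 2s≤F = good (R ⊕ pile x (2 * a)) (≤-trans N≤ enlarged)
          H' , moves' , F≤H' = removal-at G moves x
          D' , moves'' , D'x' = repeatedMoves G' refl (s ∸ a) {a ∷ H'} (enough F≤H' 2s≤F)
      in D' , lift a moves' ◅◅ moves'' ,
         ≤-trans (m≤n+m∸n s a) (≤-reflexive (sym D'x'))
      where
      enlarged : a + size R ≤ size (R ⊕ pile x (2 * a))
      enlarged = begin
        a + size R             ≤⟨ +-monoˡ-≤ (size R) (m≤m+n a (a + 0)) ⟩
        2 * a + size R         ≡⟨ +-comm (2 * a) (size R) ⟩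
        size R + 2 * a         ≡⟨ sym (trans (size-⊕ R _) (cong (size R +_) (size-pile x (2 * a)))) ⟩
        size (R ⊕ pile x (2 * a)) ∎
        where open ≤-Reasoning
      enough : ∀ {f h} → f ≤ h + size (pile x (2 * a)) → 2 * s ≤ f → 2 * (s ∸ a) ≤ h
      enough {f} {h} f≤ 2s≤f = begin
        2 * (s ∸ a)     ≡⟨ *-distribˡ-∸ 2 s a ⟩
        2 * s ∸ 2 * a   ≤⟨ m≤n+o⇒m∸n≤o (2 * s) (2 * a) within ⟩
        h               ∎
        where
        open ≤-Reasoning
        within : 2 * s ≤ 2 * a + h
        within = ≤-trans 2s≤f (≤-trans f≤ (≤-reflexive
                   (trans (cong (h +_) (size-pile x (2 * a))) (+-comm h (2 * a)))))

  base-good : ∀ s N → Good G' s zero N → Good G (2 * s) x N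
  base-good s N good D N≤ =
    let F , moves , s≤F = good (0 ∷ D) (≤-trans N≤ (≤-reflexive (sym (size-tail (0 ∷ D)))))
        H' , moves' , dom = project moves initial
    in H' , moves' , (begin
      2 * s                        ≤⟨ *-monoʳ-≤ 2 s≤F ⟩
      2 * head F                   ≤⟨ m≤n+m _ (F (suc x)) ⟩
      F (suc x) + 2 * head F       ≡⟨ sym (collapse-at-x F) ⟩
      collapse F x                 ≤⟨ dom x ⟩
      H' x                         ∎)
    where
    open ≤-Reasoning
    initial : collapse (0 ∷ D) ≤ᴰ D
    initial k = ≤-reflexive (trans (cong (D k +_) (pile-empty x k)) (+-identityʳ (D k)))

pebbling-number-transfer : ∀ {m} {G : Graph n} {H : Graph m} {t t' v v'} →
  (∀ N → Good G t v N ⇔ Good H t' v' N) →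
  (∀ N → IsPebblingNumber G t v N ⇔ IsPebblingNumber H t' v' N)
  × (PebblingNumberInfinite G t v ⇔ PebblingNumberInfinite H t' v')
pebbling-number-transfer same =
  (λ N → mk⇔ (λ (good , least) → to N good , λ M g → least M (from M g))
             (λ (good , least) → from N good , λ M g → least M (to M g))) ,
  mk⇔ (λ never N g → never N (from N g)) (λ never N g → never N (to N g))
  where
  to   = λ N → Equivalence.to (same N)
  from = λ N → Equivalence.from (same N)

proposition3p4 : ∀ {n} (G : Graph n) (s : ℕ) (x : Fin n) → 1 ≤ s →
    (∀ N → IsPebblingNumber G (2 * s) x N ⇔ IsPebblingNumber (addPendant G x) (s) newVertex N)
    × (PebblingNumberInfinite G (2 * s) x ⇔ PebblingNumberInfinite (addPendant G x) (s) newVertex)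
proposition3p4 G s x _ =
  pebbling-number-transfer {G = G} {G'} {2 * s} {s} {x} {newVertex}
    (λ N → mk⇔ (pendant-good s N) (base-good s N))
  where open Pendant G x
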